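{- Let $k,n$ be positive integers, $m=(n-1)k+1$. For every chain $\omega\in\Delta(\Pi^{(k)}_m)$, the set $F^k(\omega):=\bigcup_{x\in\omega}\max\mathcal{G}_{\le x}$ belongs to $\mathcal{N}$.
   Context: $\Pi_m$ is the lattice of set partitions of $\{1,\dots,m\}$ ordered by refinement, $\mathrm{rk}(x)=m-(\text{number of blocks of }x)$, and $\Pi^{(k)}_m\subseteq\Pi_m$ is the subposet of partitions with all block sizes congruent to $1$ modulo $k$. $\Delta(\Pi^{(k)}_m)$ is the order complex of the proper part of $\Pi^{(k)}_m$ (nonempty chains avoiding the minimal and maximal elements). $\mathcal{I}$ is the set of partitions with exactly one block of size larger than $1$, and $\mathcal{G}=\{x\in\mathcal{I}\mid\mathrm{rk}(x)\equiv0\pmod k\}$; $\mathcal{G}_{\le x}=\{g\in\mathcal{G}\mid g\le x\}$ and $\max$ denotes the set of maximal elements. For $x_1,\dots,x_\ell\in\Pi^{(k)}_m$ say that their join exists uniquely if $\{x_1,\dots,x_\ell\}$ has exactly one minimal upper bound in $\Pi^{(k)}_m$, denoted $x_1\vee^k\dots\vee^k x_\ell$. $\mathcal{N}$ is the family of all nonempty subsets $N\subseteq\mathcal{G}$ not containing the maximal partition such that for every set $\{x_1,\dots,x_\ell\}\subseteq N$ of $\ell\ge2$ pairwise incomparable elements, $x_1\vee^k\dots\vee^k x_\ell$ exists uniquely and is not in $\mathcal{G}$. -}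

module Defs where

open import Data.Nat using (ℕ; zero; suc; _+_; _*_; _∸_; _≤_; _<_; _<ᵇ_; NonZero)
open import Data.Nat.DivMod using (_%_)
open import Data.Bool using (Bool; true; false; not; _∧_)
open import Data.Fin using (Fin; toℕ)
open import Data.List using (List; []; _∷_; length; filterᵇ; allFin)
open import Data.Bool.ListAction using (any)
open import Data.List.Membership.Propositional using (_∈_)
open import Data.List.Relation.Unary.All using (All)
open import Data.List.Relation.Unary.AllPairs using (AllPairs)
open import Data.Product using (Σ; _×_; ∃; ∃-syntax; _,_)
open import Relation.Binary.PropositionalEquality using (_≡_)
open import Relation.Nullary using (¬_)

-- A set partition of {1,…,m} (modelled as Fin m), given by its
-- (decidable) equivalence relation "i and j lie in the same block".
record Partition (m : ℕ) : Set where
  field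
    rel   : Fin m → Fin m → Bool
    refl  : ∀ i → rel i i ≡ true
    sym   : ∀ i j → rel i j ≡ true → rel j i ≡ true
    trans : ∀ i j l → rel i j ≡ true → rel j l ≡ true → rel i l ≡ true
open Partition public

module _ {m : ℕ} where

  _≤ₚ_ : Partition m → Partition m → Set
  x ≤ₚ y = ∀ i j → rel x i j ≡ true → rel y i j ≡ true

  _≈ₚ_ : Partition m → Partition m → Set
  x ≈ₚ y = (x ≤ₚ y) × (y ≤ₚ x)

  _<ₚ_ : Partition m → Partition m → Set
  x <ₚ y = (x ≤ₚ y) × ¬ (y ≤ₚ x)

  blockSize : Partition m → Fin m → ℕ
  blockSize x i = length (filterᵇ (rel x i) (allFin m))

  isLeader : Partition m → Fin m → Bool
  isLeader x i = not (any (λ j → (toℕ j <ᵇ toℕ i) ∧ rel x i j) (allFin m))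

  numBlocks : Partition m → ℕ
  numBlocks x = length (filterᵇ (isLeader x) (allFin m))

  rk : Partition m → ℕ
  rk x = m ∸ numBlocks x

  IsBottom : Partition m → Set
  IsBottom x = ∀ i j → rel x i j ≡ true → i ≡ j

  IsTop : Partition m → Set
  IsTop x = ∀ i j → rel x i j ≡ true

  InI : Partition m → Set
  InI x = Σ (Fin m) λ i → (1 < blockSize x i)
          × (∀ j → 1 < blockSize x j → rel x i j ≡ true)

module _ {m : ℕ} (k : ℕ) .{{_ : NonZero k}} where

  InPik : Partition m → Set
  InPik x = ∀ i → blockSize x i % k ≡ 1 % k

  InG : Partition m → Set
  InG x = InI x × (rk x % k ≡ 0)

  InMaxGle : Partition m → Partition m → Set
  InMaxGle x g = InG g × (g ≤ₚ x)
                 × (∀ g′ → InG g′ → g′ ≤ₚ x → g ≤ₚ g′ → g′ ≤ₚ g)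

  -- ω ∈ Δ(Π^(k)_m): a nonempty chain of the proper part of Π^(k)_m,
  -- listed in strictly increasing order.  (The minimal and maximal
  -- elements of Π^(k)_m are the discrete and the one-block partitions.)
  IsChainΔ : List (Partition m) → Set
  IsChainΔ ω = (1 ≤ length ω)
             × All (λ x → InPik x × ¬ IsBottom x × ¬ IsTop x) ω
             × AllPairs _<ₚ_ ω

  Fk : List (Partition m) → Partition m → Set
  Fk ω g = ∃[ x ] (x ∈ ω × InMaxGle x g)

  IsUB : List (Partition m) → Partition m → Set
  IsUB xs u = InPik u × All (λ x → x ≤ₚ u) xs

  IsMinUB : List (Partition m) → Partition m → Set
  IsMinUB xs u = IsUB xs u × (∀ v → IsUB xs v → v ≤ₚ u → u ≤ₚ v)

  IsUniqueJoin : List (Partition m) → Partition m → Set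
  IsUniqueJoin xs u = IsMinUB xs u × (∀ u′ → IsMinUB xs u′ → u′ ≈ₚ u)

  Incomparable : Partition m → Partition m → Set
  Incomparable x y = ¬ (x ≤ₚ y) × ¬ (y ≤ₚ x)

  InN : (Partition m → Set) → Set
  InN N = (∀ g → N g → InG g)
        × (∃[ g ] N g)
        × (∀ g → N g → ¬ IsTop g)
        × (∀ (xs : List (Partition m)) → 2 ≤ length xs → All N xs
             → AllPairs Incomparable xs
             → ∃[ u ] (IsUniqueJoin xs u × ¬ InG u))

-- For x ∈ Π^(k)_m, the elements of max 𝒢_{≤x} are the partitions block x b that keep one
-- non-singleton block of x (the one containing b) and split everything else into singletons:
-- the rank of block x b is the size of that block minus one, a multiple of k, and a member of
-- max 𝒢_{≤x} whose non-trivial block contains b must be block x b. Since block x b ≤ block y b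
-- whenever x ≤ y and ω is a chain, two members of F^k(ω) whose non-trivial blocks meet are
-- comparable. Hence pairwise incomparable members have disjoint non-trivial blocks, and their
-- union is a partition. Each of its blocks is a singleton or a block of some x ∈ ω, so it lies in
-- Π^(k)_m. As their least upper bound in Π_m, it is their unique minimal upper bound in Π^(k)_m,
-- and it has at least two non-trivial blocks, so it is not in 𝒢.

{-# OPTIONS --safe #-}
module Submission where

open import Defs renaming (refl to rel-refl; sym to rel-sym; trans to rel-trans)
open import Data.Nat using (ℕ; zero; suc; pred; _+_; _*_; _∸_; _≤_; _<_; _<ᵇ_; NonZero; z≤n; s≤s)
open import Data.Nat.Properties using (m+n∸n≡m; +-suc; +-comm; <⇒≢)
open import Data.Nat.DivMod using (_%_; _/_; m≡m%n+[m/n]*n; m*n%n≡0; n%1≡0)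
open import Data.Bool using (Bool; true; false; not; _∧_; _∨_; if_then_else_)
open import Data.Bool.Properties using (∧-zeroʳ) renaming (_≟_ to _≟ᵇ_)
open import Data.Fin using (Fin; zero; suc; toℕ; _≟_)
open import Data.Fin.Properties using (suc-injective; any?)
open import Data.List using (List; []; _∷_; length; filterᵇ; tabulate)
open import Data.Bool.ListAction using (any)
open import Data.List.Membership.Propositional using (_∈_)
open import Data.List.Relation.Unary.Any using (here; there)
open import Data.List.Relation.Unary.All as All using (All; []; _∷_)
open import Data.List.Relation.Unary.AllPairs using (AllPairs; []; _∷_)
open import Data.Product using (∃; ∃-syntax; _×_; _,_; proj₁; proj₂)
open import Data.Sum using (_⊎_; inj₁; inj₂; [_,_]; [_,_]′)
open import Data.Empty using (⊥-elim)
open import Function using (_∘_; id)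
open import Relation.Binary.PropositionalEquality
  using (_≡_; _≢_; refl; sym; trans; cong; cong₂; subst; ≢-sym; module ≡-Reasoning)
open import Relation.Nullary using (¬_; Dec; does; yes; no)
open import Relation.Nullary.Decidable using (map′; _×-dec_; ¬?; dec-true; decidable-stable; toSum)

bool-ext : ∀ {p q} → (p ≡ true → q ≡ true) → (q ≡ true → p ≡ true) → p ≡ q
bool-ext {true}          p⇒q q⇒p = sym (p⇒q refl)
bool-ext {false} {true}  p⇒q q⇒p = q⇒p refl
bool-ext {false} {false} p⇒q q⇒p = refl

∨-introˡ : ∀ {p} q → p ≡ true → p ∨ q ≡ true
∨-introˡ q refl = refl

∨-introʳ : ∀ p {q} → q ≡ true → p ∨ q ≡ true
∨-introʳ true  _  = refl
∨-introʳ false eq = eq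

∨-elim : ∀ {p q} → p ∨ q ≡ true → p ≡ true ⊎ q ≡ true
∨-elim {true}  _  = inj₁ refl
∨-elim {false} eq = inj₂ eq

∧-intro : ∀ {p q} → p ≡ true → q ≡ true → p ∧ q ≡ true
∧-intro refl eq = eq

∧-elim : ∀ {p q} → p ∧ q ≡ true → p ≡ true × q ≡ true
∧-elim {true} eq = refl , eq

n<ᵇn≡false : ∀ n → (n <ᵇ n) ≡ false
n<ᵇn≡false zero    = refl
n<ᵇn≡false (suc n) = n<ᵇn≡false n

does-≟⇒≡ : ∀ {n} {a c : Fin n} → does (a ≟ c) ≡ true → a ≡ c
does-≟⇒≡ {a = a} {c} eq with a ≟ c
... | yes a≡c = a≡c

[1+m]%n≡1%n⇒m%n≡0 : ∀ m n .{{_ : NonZero n}} → suc m % n ≡ 1 % n → m % n ≡ 0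
[1+m]%n≡1%n⇒m%n≡0 m (suc zero)      _  = n%1≡0 m
[1+m]%n≡1%n⇒m%n≡0 m n@(suc (suc _)) eq = begin
  m % n               ≡⟨ cong (_% n) m≡q*n ⟩
  (suc m / n * n) % n ≡⟨ m*n%n≡0 (suc m / n) n ⟩
  0                   ∎
  where
  open ≡-Reasoning
  m≡q*n : m ≡ suc m / n * n
  m≡q*n = cong pred (trans (m≡m%n+[m/n]*n (suc m) n) (cong (_+ suc m / n * n) eq))

AllPairs-∈ : ∀ {A : Set} {R : A → A → Set} {xs : List A} {x y : A}
           → AllPairs R xs → x ∈ xs → y ∈ xs → x ≡ y ⊎ R x y ⊎ R y x
AllPairs-∈ (_  ∷ _)   (here refl) (here refl) = inj₁ refl
AllPairs-∈ (Rx ∷ _)   (here refl) (there y∈)  = inj₂ (inj₁ (All.lookup Rx y∈))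
AllPairs-∈ (Ry ∷ _)   (there x∈)  (here refl) = inj₂ (inj₂ (All.lookup Ry x∈))
AllPairs-∈ (_  ∷ Rxs) (there x∈)  (there y∈)  = AllPairs-∈ Rxs x∈ y∈

count : ∀ {n} → (Fin n → Bool) → ℕ
count {zero}  p = 0
count {suc n} p = if p zero then suc (count (p ∘ suc)) else count (p ∘ suc)

anyᶠ : ∀ {n} → (Fin n → Bool) → Bool
anyᶠ {zero}  p = false
anyᶠ {suc n} p = p zero ∨ anyᶠ (p ∘ suc)

existsBelow : ∀ {n} → (Fin n → Bool) → Fin n → Bool
existsBelow p a = anyᶠ (λ j → (toℕ j <ᵇ toℕ a) ∧ p j)

module _ {A : Set} (p : A → Bool) where

  length-filterᵇ-tabulate : ∀ {n} (f : Fin n → A) → length (filterᵇ p (tabulate f)) ≡ count (p ∘ f)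
  length-filterᵇ-tabulate {zero}  f = refl
  length-filterᵇ-tabulate {suc n} f with p (f zero)
  ... | true  = cong suc (length-filterᵇ-tabulate (f ∘ suc))
  ... | false = length-filterᵇ-tabulate (f ∘ suc)

  any-tabulate : ∀ {n} (f : Fin n → A) → any p (tabulate f) ≡ anyᶠ (p ∘ f)
  any-tabulate {zero}  f = refl
  any-tabulate {suc n} f = cong (p (f zero) ∨_) (any-tabulate (f ∘ suc))

count-cong : ∀ {n} {p q : Fin n → Bool} → (∀ i → p i ≡ q i) → count p ≡ count q
count-cong {zero}          p≗q = refl
count-cong {suc n} {p} {q} p≗q rewrite p≗q zero =
  cong (λ c → if q zero then suc c else c) (count-cong (p≗q ∘ suc))

count+count-not : ∀ {n} (p : Fin n → Bool) → count p + count (not ∘ p) ≡ n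
count+count-not {zero}  p = refl
count+count-not {suc n} p with p zero
... | true  = cong suc (count+count-not (p ∘ suc))
... | false = trans (+-suc (count (p ∘ suc)) _) (cong suc (count+count-not (p ∘ suc)))

count-split : ∀ {n} (p q : Fin n → Bool)
            → count p ≡ count (λ i → p i ∧ q i) + count (λ i → p i ∧ not (q i))
count-split {zero}  p q = refl
count-split {suc n} p q with p zero | q zero
... | true  | true  = cong suc (count-split (p ∘ suc) (q ∘ suc))
... | true  | false = trans (cong suc (count-split (p ∘ suc) (q ∘ suc))) (sym (+-suc _ _))
... | false | _     = count-split (p ∘ suc) (q ∘ suc)

count-none : ∀ {n} (p : Fin n → Bool) → (∀ i → p i ≡ false) → count p ≡ 0
count-none {zero}  p none = refl
count-none {suc n} p none rewrite none zero = count-none (p ∘ suc) (none ∘ suc)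

count-unique : ∀ {n} (p : Fin n → Bool) {a} → p a ≡ true → (∀ c → p c ≡ true → c ≡ a) → count p ≡ 1
count-unique {suc n} p {zero} pa unique rewrite pa = cong suc (count-none (p ∘ suc) others)
  where
  others : ∀ i → p (suc i) ≡ false
  others i with p (suc i) in pi
  ... | true  with () ← unique (suc i) pi
  ... | false = refl
count-unique {suc n} p {suc a} pa unique with p zero in p0
... | true  with () ← unique zero p0
... | false = count-unique (p ∘ suc) pa (λ c pc → suc-injective (unique (suc c) pc))

count-≥1 : ∀ {n} (p : Fin n → Bool) {a} → p a ≡ true → 1 ≤ count p
count-≥1 {suc n} p {zero}  pa rewrite pa = s≤s z≤n
count-≥1 {suc n} p {suc a} pa with p zero
... | true  = s≤s z≤n
... | false = count-≥1 (p ∘ suc) pa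

count-≥2 : ∀ {n} (p : Fin n → Bool) {a c} → p a ≡ true → p c ≡ true → a ≢ c → 2 ≤ count p
count-≥2 {suc n} p {zero}  {zero}  _  _  a≢c = ⊥-elim (a≢c refl)
count-≥2 {suc n} p {zero}  {suc c} pa pc _   rewrite pa = s≤s (count-≥1 (p ∘ suc) pc)
count-≥2 {suc n} p {suc a} {zero}  pa pc _   rewrite pc = s≤s (count-≥1 (p ∘ suc) pa)
count-≥2 {suc n} p {suc a} {suc c} pa pc a≢c with p zero
... | true  = s≤s (count-≥1 (p ∘ suc) pa)
... | false = count-≥2 (p ∘ suc) pa pc (a≢c ∘ cong suc)

anyᶠ-none : ∀ {n} (p : Fin n → Bool) → (∀ i → p i ≡ false) → anyᶠ p ≡ false
anyᶠ-none {zero}  p none = refl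
anyᶠ-none {suc n} p none rewrite none zero = anyᶠ-none (p ∘ suc) (none ∘ suc)

anyᶠ-cong : ∀ {n} {p q : Fin n → Bool} → (∀ i → p i ≡ q i) → anyᶠ p ≡ anyᶠ q
anyᶠ-cong {zero}  p≗q = refl
anyᶠ-cong {suc n} p≗q = cong₂ _∨_ (p≗q zero) (anyᶠ-cong (p≗q ∘ suc))

anyᶠ-∧ˡ : ∀ {n} b (p : Fin n → Bool) → anyᶠ (λ j → b ∧ p j) ≡ b ∧ anyᶠ p
anyᶠ-∧ˡ true  p = refl
anyᶠ-∧ˡ false p = anyᶠ-none (λ j → false ∧ p j) (λ _ → refl)

-- existsBelow p zero computes to anyᶠ (λ _ → false),
-- and existsBelow p (suc i) to p zero ∨ existsBelow (p ∘ suc) i.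
count-least≡1 : ∀ {n} (p : Fin n → Bool) {a} → p a ≡ true
              → count (λ i → p i ∧ not (existsBelow p i)) ≡ 1
count-least≡1 {suc n} p {a} pa rewrite anyᶠ-none {n} (λ _ → false) (λ _ → refl) with p zero in p0 | a
... | true  | _     = cong suc (count-none _ (λ i → ∧-zeroʳ (p (suc i))))
... | false | zero  with () ← trans (sym pa) p0
... | false | suc a = count-least≡1 (p ∘ suc) pa

module _ {m : ℕ} where

  private variable
    x g : Partition m
    a : Fin m

  ≤ₚ-refl : ∀ (x : Partition m) → x ≤ₚ x
  ≤ₚ-refl x _ _ r = r

  record Nonsingleton (x : Partition m) (a : Fin m) : Set where
    constructor nonsingleton
    field
      {partner} : Fin m
      partner≢  : partner ≢ a
      related   : rel x a partner ≡ true

  nonsingleton? : ∀ x a → Dec (Nonsingleton x a)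
  nonsingleton? x a =
    map′ (λ (_ , c≢a , r) → nonsingleton c≢a r) (λ (nonsingleton c≢a r) → _ , c≢a , r)
         (any? (λ c → ¬? (c ≟ a) ×-dec (rel x a c ≟ᵇ true)))

  ≤ₚ-nonsingleton : ∀ y → x ≤ₚ y → Nonsingleton x a → Nonsingleton y a
  ≤ₚ-nonsingleton {a = a} y x≤y (nonsingleton c≢a r) = nonsingleton c≢a (x≤y a _ r)

  nonsingleton-resp-rel : ∀ x {a c} → rel x a c ≡ true → Nonsingleton x a → Nonsingleton x c
  nonsingleton-resp-rel x {a} {c} r na with c ≟ a
  ... | yes refl = na
  ... | no c≢a   = nonsingleton (≢-sym c≢a) (rel-sym x a c r)

  ¬IsBottom⇒nonsingleton : ¬ IsBottom x → ∃ (Nonsingleton x)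
  ¬IsBottom⇒nonsingleton {x} ¬bottom = decidable-stable (any? (nonsingleton? x)) λ none →
    ¬bottom λ i j r → decidable-stable (i ≟ j) λ i≢j → none (i , nonsingleton (≢-sym i≢j) r)

  blockSize≡count : ∀ (x : Partition m) a → blockSize x a ≡ count (rel x a)
  blockSize≡count x a = length-filterᵇ-tabulate (rel x a) id

  blockSize-cong : ∀ x y {a} → (∀ c → rel x a c ≡ rel y a c) → blockSize x a ≡ blockSize y a
  blockSize-cong x y {a} rows = begin
    blockSize x a   ≡⟨ blockSize≡count x a ⟩
    count (rel x a) ≡⟨ count-cong rows ⟩
    count (rel y a) ≡⟨ blockSize≡count y a ⟨
    blockSize y a   ∎
    where open ≡-Reasoning

  nonsingleton⇒1<blockSize : Nonsingleton x a → 1 < blockSize x a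
  nonsingleton⇒1<blockSize {x} {a} (nonsingleton c≢a r) =
    subst (1 <_) (sym (blockSize≡count x a)) (count-≥2 (rel x a) (rel-refl x a) r (≢-sym c≢a))

  singleton⇒blockSize≡1 : ¬ Nonsingleton x a → blockSize x a ≡ 1
  singleton⇒blockSize≡1 {x} {a} singleton = trans (blockSize≡count x a)
    (count-unique (rel x a) (rel-refl x a) λ c r →
      decidable-stable (c ≟ a) λ c≢a → singleton (nonsingleton c≢a r))

  1<blockSize⇒nonsingleton : 1 < blockSize x a → Nonsingleton x a
  1<blockSize⇒nonsingleton {x} {a} 1<size = decidable-stable (nonsingleton? x a) λ singleton →
    <⇒≢ 1<size (sym (singleton⇒blockSize≡1 singleton))

  InI⇒nonsingleton : InI g → ∃ (Nonsingleton g)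
  InI⇒nonsingleton (i , 1<size , _) = i , 1<blockSize⇒nonsingleton 1<size

  InI⇒nonsingletons-related : ∀ {c} → InI g → Nonsingleton g a → Nonsingleton g c → rel g a c ≡ true
  InI⇒nonsingletons-related {g} {a} {c} (i , _ , hub) na nc =
    rel-trans g a i c (rel-sym g i a (hub a (nonsingleton⇒1<blockSize na)))
                      (hub c (nonsingleton⇒1<blockSize nc))

  blockRel : Partition m → Fin m → Fin m → Fin m → Bool
  blockRel x b a c = does (a ≟ c) ∨ (rel x b a ∧ rel x b c)

  blockRel-refl : ∀ x b a → blockRel x b a a ≡ true
  blockRel-refl x b a = ∨-introˡ _ (dec-true (a ≟ a) refl)

  blockRel-intro : ∀ x b {a c} → rel x b a ≡ true → rel x b c ≡ true → blockRel x b a c ≡ true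
  blockRel-intro x b {a} ba bc = ∨-introʳ (does (a ≟ _)) (∧-intro ba bc)

  blockRel-elim : ∀ x b {a c} → blockRel x b a c ≡ true
                → a ≡ c ⊎ (rel x b a ≡ true × rel x b c ≡ true)
  blockRel-elim x b {a} r with ∨-elim {does (a ≟ _)} r
  ... | inj₁ a≡c   = inj₁ (does-≟⇒≡ a≡c)
  ... | inj₂ ba∧bc = inj₂ (∧-elim ba∧bc)

  block : Partition m → Fin m → Partition m
  block x b = record
    { rel   = blockRel x b
    ; refl  = blockRel-refl x b
    ; sym   = symmetric
    ; trans = transitive
    }
    where
    symmetric : ∀ a c → blockRel x b a c ≡ true → blockRel x b c a ≡ true
    symmetric a c r with blockRel-elim x b r
    ... | inj₁ refl      = blockRel-refl x b a
    ... | inj₂ (ba , bc) = blockRel-intro x b bc ba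
    transitive : ∀ a c l → blockRel x b a c ≡ true → blockRel x b c l ≡ true → blockRel x b a l ≡ true
    transitive a c l r₁ r₂ with blockRel-elim x b r₁ | blockRel-elim x b r₂
    ... | inj₁ refl     | _             = r₂
    ... | _             | inj₁ refl     = r₁
    ... | inj₂ (ba , _) | inj₂ (_ , bl) = blockRel-intro x b ba bl

  block≤ : ∀ x b → block x b ≤ₚ x
  block≤ x b a c r with blockRel-elim x b r
  ... | inj₁ refl      = rel-refl x a
  ... | inj₂ (ba , bc) = rel-trans x a b c (rel-sym x b a ba) bc

  block-mono : ∀ x y b → x ≤ₚ y → block x b ≤ₚ block y b
  block-mono x y b x≤y a c r with blockRel-elim x b r
  ... | inj₁ refl      = blockRel-refl y b a
  ... | inj₂ (ba , bc) = blockRel-intro y b (x≤y b a ba) (x≤y b c bc)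

  block-row : ∀ x b {a} → rel x b a ≡ true → ∀ c → rel (block x b) a c ≡ rel x a c
  block-row x b {a} ba c =
    bool-ext (block≤ x b a c) (λ ac → blockRel-intro x b ba (rel-trans x b a c ba ac))

  block-nonsingleton : Nonsingleton x a → Nonsingleton (block x a) a
  block-nonsingleton {x} {a} (nonsingleton c≢a ac) =
    nonsingleton c≢a (blockRel-intro x a (rel-refl x a) ac)

  nonsingleton-block⇒rel : ∀ x b {a} → Nonsingleton (block x b) a → rel x b a ≡ true
  nonsingleton-block⇒rel x b (nonsingleton c≢a r) with blockRel-elim x b r
  ... | inj₁ a≡c      = ⊥-elim (c≢a (sym a≡c))
  ... | inj₂ (ba , _) = ba

  block-InI : Nonsingleton x a → InI (block x a)
  block-InI {x} {a} na = a , nonsingleton⇒1<blockSize (block-nonsingleton na) , λ c 1<size →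
    blockRel-intro x a (rel-refl x a) (nonsingleton-block⇒rel x a (1<blockSize⇒nonsingleton 1<size))

  InI-≤-block : ∀ x {b} → InI g → g ≤ₚ x → Nonsingleton g b → g ≤ₚ block x b
  InI-≤-block {g} x {b} Ig g≤x nb p q r = [ (λ { refl → blockRel-refl x b p }) , p≢q⇒ ]′ (toSum (p ≟ q))
    where
    hub : ∀ {c} → Nonsingleton g c → rel g b c ≡ true
    hub = InI⇒nonsingletons-related Ig nb
    p≢q⇒ : p ≢ q → blockRel x b p q ≡ true
    p≢q⇒ p≢q = blockRel-intro x b (g≤x b p (hub (nonsingleton (≢-sym p≢q) r)))
                                  (g≤x b q (hub (nonsingleton p≢q (rel-sym g p q r))))

  isLeader-block : ∀ x b a → isLeader (block x b) a ≡ not (rel x b a ∧ existsBelow (rel x b) a)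
  isLeader-block x b a = cong not (begin
    any (λ j → (toℕ j <ᵇ toℕ a) ∧ blockRel x b a j) (tabulate id) ≡⟨ any-tabulate _ {m} id ⟩
    anyᶠ (λ j → (toℕ j <ᵇ toℕ a) ∧ blockRel x b a j)              ≡⟨ anyᶠ-cong below ⟩
    anyᶠ (λ j → rel x b a ∧ ((toℕ j <ᵇ toℕ a) ∧ rel x b j))       ≡⟨ anyᶠ-∧ˡ {m} (rel x b a) _ ⟩
    rel x b a ∧ existsBelow (rel x b) a                           ∎)
    where
    open ≡-Reasoning
    below : ∀ j → (toℕ j <ᵇ toℕ a) ∧ blockRel x b a j ≡ rel x b a ∧ ((toℕ j <ᵇ toℕ a) ∧ rel x b j)
    below j with a ≟ j
    ... | yes refl rewrite n<ᵇn≡false (toℕ a) = sym (∧-zeroʳ (rel x b a))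
    ... | no _ with toℕ j <ᵇ toℕ a
    ...   | true  = refl
    ...   | false = sym (∧-zeroʳ (rel x b a))

  -- The non-leaders of block x b are the elements of the block of b other than its least one.
  suc-rk-block : ∀ x b → suc (rk (block x b)) ≡ blockSize x b
  suc-rk-block x b = begin
    suc (rk (block x b))      ≡⟨ cong suc rk≡ ⟩
    suc (count later)         ≡⟨ +-comm 1 (count later) ⟩
    count later + 1           ≡⟨ cong (count later +_) (count-least≡1 (rel x b) (rel-refl x b)) ⟨
    count later + count least ≡⟨ count-split (rel x b) (existsBelow (rel x b)) ⟨
    count (rel x b)           ≡⟨ blockSize≡count x b ⟨
    blockSize x b             ∎
    where
    open ≡-Reasoning
    later least : Fin m → Bool
    later a = rel x b a ∧ existsBelow (rel x b) a
    least a = rel x b a ∧ not (existsBelow (rel x b) a)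
    blocks = numBlocks (block x b)
    blocks≡ : blocks ≡ count (not ∘ later)
    blocks≡ = trans (length-filterᵇ-tabulate _ {m} id) (count-cong (isLeader-block x b))
    rk≡ : rk (block x b) ≡ count later
    rk≡ = begin
      m ∸ blocks                                  ≡⟨ cong (_∸ blocks) (count+count-not later) ⟨
      count later + count (not ∘ later) ∸ blocks ≡⟨ cong (λ t → count later + t ∸ blocks) blocks≡ ⟨
      count later + blocks ∸ blocks               ≡⟨ m+n∸n≡m (count later) blocks ⟩
      count later                                 ∎

  unionRel : List (Partition m) → Fin m → Fin m → Bool
  unionRel []       a c = does (a ≟ c)
  unionRel (g ∷ gs) a c = rel g a c ∨ unionRel gs a c

  unionRel-refl : ∀ gs a → unionRel gs a a ≡ true
  unionRel-refl []       a = dec-true (a ≟ a) refl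
  unionRel-refl (g ∷ gs) a = ∨-introʳ (rel g a a) (unionRel-refl gs a)

  unionRel-intro : ∀ {gs g a c} → g ∈ gs → rel g a c ≡ true → unionRel gs a c ≡ true
  unionRel-intro           (here refl) r = ∨-introˡ _ r
  unionRel-intro {g ∷ _} (there g∈)  r = ∨-introʳ (rel g _ _) (unionRel-intro g∈ r)

  unionRel-elim : ∀ gs {a c} → unionRel gs a c ≡ true → a ≡ c ⊎ ∃[ g ] (g ∈ gs × rel g a c ≡ true)
  unionRel-elim []       r = inj₁ (does-≟⇒≡ r)
  unionRel-elim (g ∷ gs) {a} {c} r with ∨-elim {rel g a c} r
  ... | inj₁ ac = inj₂ (g , here refl , ac)
  ... | inj₂ r′ with unionRel-elim gs r′
  ...   | inj₁ a≡c            = inj₁ a≡c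
  ...   | inj₂ (h , h∈ , ac) = inj₂ (h , there h∈ , ac)

module _ {m : ℕ} (k : ℕ) .{{_ : NonZero k}} where

  private variable
    x g : Partition m
    a : Fin m

  InPik-from-rows : (∀ a → Nonsingleton x a → ∃[ y ] (InPik k y × ∀ c → rel x a c ≡ rel y a c))
                  → InPik k x
  InPik-from-rows {x} rows a with nonsingleton? x a
  ... | no singleton = cong (_% k) (singleton⇒blockSize≡1 singleton)
  ... | yes na with rows a na
  ...   | y , y∈Πk , same = trans (cong (_% k) (blockSize-cong x y same)) (y∈Πk a)

  block∈G : InPik k x → Nonsingleton x a → InG k (block x a)
  block∈G {x} {a} x∈Πk na = block-InI na ,
    [1+m]%n≡1%n⇒m%n≡0 _ k (subst (λ s → s % k ≡ 1 % k) (sym (suc-rk-block x a)) (x∈Πk a))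

  block∈maxG : InPik k x → Nonsingleton x a → InMaxGle k x (block x a)
  block∈maxG {x} {a} x∈Πk na = block∈G x∈Πk na , block≤ x a , λ g (Ig , _) g≤x block≤g →
    InI-≤-block x Ig g≤x (≤ₚ-nonsingleton g block≤g (block-nonsingleton na))

  maxG≈block : ∀ x → InPik k x → InMaxGle k x g → Nonsingleton g a → g ≈ₚ block x a
  maxG≈block {g} {a} x x∈Πk ((Ig , _) , g≤x , maximal) na =
    g≤block , maximal (block x a) (block∈G x∈Πk (≤ₚ-nonsingleton x g≤x na)) (block≤ x a) g≤block
    where
    g≤block : g ≤ₚ block x a
    g≤block = InI-≤-block x Ig g≤x na

  maxG-row : ∀ x → InPik k x → InMaxGle k x g → Nonsingleton g a → ∀ c → rel g a c ≡ rel x a c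
  maxG-row {g} {a} x x∈Πk maxg na c =
    trans (bool-ext (g≤block a c) (block≤g a c)) (block-row x a (rel-refl x a) c)
    where
    g≤block = proj₁ (maxG≈block x x∈Πk maxg na)
    block≤g = proj₂ (maxG≈block x x∈Πk maxg na)

  maxG∈Pik : ∀ x g → InPik k x → InMaxGle k x g → InPik k g
  maxG∈Pik x g x∈Πk maxg = InPik-from-rows {x = g} λ a na → x , x∈Πk , maxG-row x x∈Πk maxg na

  maxG-mono : ∀ x y {g h b} → InPik k x → InPik k y → x ≤ₚ y → InMaxGle k x g → InMaxGle k y h
            → Nonsingleton g b → Nonsingleton h b → g ≤ₚ h
  maxG-mono x y {b = b} x∈Πk y∈Πk x≤y maxg maxh ng nh p q =
    block≤h p q ∘ block-mono x y b x≤y p q ∘ g≤block p q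
    where
    g≤block = proj₁ (maxG≈block x x∈Πk maxg ng)
    block≤h = proj₂ (maxG≈block y y∈Πk maxh nh)

  lub⇒uniqueJoin : ∀ {xs : List (Partition m)} {u} → IsUB k xs u
                 → (∀ v → All (_≤ₚ v) xs → u ≤ₚ v) → IsUniqueJoin k xs u
  lub⇒uniqueJoin {u = u} ub least =
    (ub , λ v ub-v _ → least v (proj₂ ub-v)) ,
    λ u′ ((_ , ≤u′) , minimal) → minimal u ub (least u′ ≤u′) , least u′ ≤u′

  Fk-nonempty : ∀ {ω : List (Partition m)} → IsChainΔ k ω → ∃ (Fk k ω)
  Fk-nonempty {[]}    (() , _)
  Fk-nonempty {x ∷ _} (_ , (x∈Πk , x≢⊥ , _) ∷ _ , _) =
    let a , na = ¬IsBottom⇒nonsingleton {x = x} x≢⊥ in block x a , x , here refl , block∈maxG x∈Πk na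

module DisjointUnion {m : ℕ} (xs : List (Partition m))
  (disjoint : ∀ {g h b} → g ∈ xs → h ∈ xs → Nonsingleton g b → Nonsingleton h b → g ≡ h) where

  union : Partition m
  union = record
    { rel   = unionRel xs
    ; refl  = unionRel-refl xs
    ; sym   = symmetric
    ; trans = transitive
    }
    where
    symmetric : ∀ a c → unionRel xs a c ≡ true → unionRel xs c a ≡ true
    symmetric a c r with unionRel-elim xs r
    ... | inj₁ refl          = unionRel-refl xs a
    ... | inj₂ (g , g∈ , ac) = unionRel-intro g∈ (rel-sym g a c ac)
    transitive : ∀ a c l → unionRel xs a c ≡ true → unionRel xs c l ≡ true → unionRel xs a l ≡ true
    transitive a c l r₁ r₂ with unionRel-elim xs r₁ | unionRel-elim xs r₂
    ... | inj₁ refl          | _                  = r₂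
    ... | _                  | inj₁ refl          = r₁
    ... | inj₂ (g , g∈ , ac) | inj₂ (h , h∈ , cl) with a ≟ c | c ≟ l
    ...   | yes refl | _        = r₂
    ...   | _        | yes refl = r₁
    ...   | no a≢c   | no c≢l
          with refl ← disjoint g∈ h∈ (nonsingleton a≢c (rel-sym g a c ac)) (nonsingleton (≢-sym c≢l) cl)
             = unionRel-intro g∈ (rel-trans g a c l ac cl)

  ≤-union : ∀ {g} → g ∈ xs → g ≤ₚ union
  ≤-union g∈ _ _ = unionRel-intro g∈

  union-least : ∀ v → All (_≤ₚ v) xs → union ≤ₚ v
  union-least v ≤v a c r with unionRel-elim xs r
  ... | inj₁ refl          = rel-refl v a
  ... | inj₂ (g , g∈ , ac) = All.lookup ≤v g∈ a c ac

  union-row : ∀ {g a} → g ∈ xs → Nonsingleton g a → ∀ c → rel union a c ≡ rel g a c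
  union-row {g} {a} g∈ na c = bool-ext from-union (unionRel-intro g∈)
    where
    from-union : unionRel xs a c ≡ true → rel g a c ≡ true
    from-union r with unionRel-elim xs r
    ... | inj₁ refl          = rel-refl g a
    ... | inj₂ (h , h∈ , ac) with c ≟ a
    ...   | yes refl = rel-refl g a
    ...   | no c≢a with refl ← disjoint h∈ g∈ (nonsingleton c≢a ac) na = ac

  union-nonsingleton : ∀ {a} → Nonsingleton union a → ∃[ g ] (g ∈ xs × Nonsingleton g a)
  union-nonsingleton (nonsingleton c≢a r) with unionRel-elim xs r
  ... | inj₁ a≡c           = ⊥-elim (c≢a (sym a≡c))
  ... | inj₂ (g , g∈ , ac) = g , g∈ , nonsingleton c≢a ac

  union∈Pik : ∀ k .{{_ : NonZero k}} → All (InPik k) xs → InPik k union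
  union∈Pik k xs⊆Πk = InPik-from-rows k λ a na →
    let g , g∈ , nga = union-nonsingleton na in g , All.lookup xs⊆Πk g∈ , union-row g∈ nga

  union∉I : ∀ {g h} → g ∈ xs → h ∈ xs → g ≢ h → ∃ (Nonsingleton g) → ∃ (Nonsingleton h)
          → ¬ InI union
  union∉I {g} g∈ h∈ g≢h (a , na) (c , nc) I = g≢h (disjoint g∈ h∈ (nonsingleton-resp-rel g ac na) nc)
    where
    ac : rel g a c ≡ true
    ac = trans (sym (union-row g∈ na c))
      (InI⇒nonsingletons-related I (≤ₚ-nonsingleton union (≤-union g∈) na)
                                   (≤ₚ-nonsingleton union (≤-union h∈) nc))

module _ {m : ℕ} (k : ℕ) .{{_ : NonZero k}} {ω : List (Partition m)} (chain : IsChainΔ k ω) where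

  private
    proper : ∀ {x} → x ∈ ω → InPik k x × ¬ IsBottom x × ¬ IsTop x
    proper = All.lookup (proj₁ (proj₂ chain))

    ω⊆Πk : ∀ {x} → x ∈ ω → InPik k x
    ω⊆Πk = proj₁ ∘ proper

  Fk-comparable : ∀ {g h b} → Fk k ω g → Fk k ω h → Nonsingleton g b → Nonsingleton h b
                → g ≤ₚ h ⊎ h ≤ₚ g
  Fk-comparable (x , x∈ , maxg) (y , y∈ , maxh) ng nh with AllPairs-∈ (proj₂ (proj₂ chain)) x∈ y∈
  ... | inj₁ refl             = inj₁ (maxG-mono k x y (ω⊆Πk x∈) (ω⊆Πk y∈) (≤ₚ-refl x) maxg maxh ng nh)
  ... | inj₂ (inj₁ (x≤y , _)) = inj₁ (maxG-mono k x y (ω⊆Πk x∈) (ω⊆Πk y∈) x≤y maxg maxh ng nh)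
  ... | inj₂ (inj₂ (y≤x , _)) = inj₂ (maxG-mono k y x (ω⊆Πk y∈) (ω⊆Πk x∈) y≤x maxh maxg nh ng)

  Fk-incomparable⇒disjoint : ∀ {xs} → All (Fk k ω) xs → AllPairs (Incomparable k) xs
    → ∀ {g h b} → g ∈ xs → h ∈ xs → Nonsingleton g b → Nonsingleton h b → g ≡ h
  Fk-incomparable⇒disjoint xs⊆F incomparable g∈ h∈ ng nh with AllPairs-∈ incomparable g∈ h∈
  ... | inj₁ g≡h                = g≡h
  ... | inj₂ (inj₁ (g≰h , h≰g)) = ⊥-elim ([ g≰h , h≰g ] comparable)
    where comparable = Fk-comparable (All.lookup xs⊆F g∈) (All.lookup xs⊆F h∈) ng nh
  ... | inj₂ (inj₂ (h≰g , g≰h)) = ⊥-elim ([ g≰h , h≰g ] comparable)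
    where comparable = Fk-comparable (All.lookup xs⊆F g∈) (All.lookup xs⊆F h∈) ng nh

  Fk-notTop : ∀ g → Fk k ω g → ¬ IsTop g
  Fk-notTop _ (x , x∈ , _ , g≤x , _) g≡⊤ = proj₂ (proj₂ (proper x∈)) λ i j → g≤x i j (g≡⊤ i j)

  Fk-join : ∀ xs → 2 ≤ length xs → All (Fk k ω) xs → AllPairs (Incomparable k) xs
          → ∃[ u ] (IsUniqueJoin k xs u × ¬ InG k u)
  Fk-join []                     ()
  Fk-join (_ ∷ [])               (s≤s ())
  Fk-join xs@(g ∷ h ∷ _) _ xs⊆F incomparable@(((g≰h , _) ∷ _) ∷ _) =
    union ,
    lub⇒uniqueJoin k {u = union} (union∈Pik k xs⊆Πk , All.tabulate ≤-union) union-least ,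
    λ (I , _) → union∉I (here refl) (there (here refl)) (λ { refl → g≰h (≤ₚ-refl g) })
                        (nonsingleton-in (here refl)) (nonsingleton-in (there (here refl))) I
    where
    open DisjointUnion xs (Fk-incomparable⇒disjoint xs⊆F incomparable)
    xs⊆Πk : All (InPik k) xs
    xs⊆Πk = All.tabulate λ {g} g∈ →
      let x , x∈ , maxg = All.lookup xs⊆F g∈ in maxG∈Pik k x g (ω⊆Πk x∈) maxg
    nonsingleton-in : ∀ {g} → g ∈ xs → ∃ (Nonsingleton g)
    nonsingleton-in g∈ = let (_ , _ , (Ig , _) , _) = All.lookup xs⊆F g∈ in InI⇒nonsingleton Ig

mainTheorem5 : (k n : ℕ) .{{_ : NonZero k}} → 1 ≤ n
    → (ω : List (Partition ((n ∸ 1) * k + 1)))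
    → IsChainΔ k ω → InN k (Fk k ω)
mainTheorem5 k n _ ω chain =
  (λ _ (_ , _ , g∈G , _) → g∈G) , Fk-nonempty k chain , Fk-notTop k chain , Fk-join k chain
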